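{- For every $N\in\{U,I,C,T,S\}$ and any two BCCSP processes $p,q$: $p\sqsubseteq_{NS}q$ if and only if $\mathit{BGO}_N(p)\subseteq\mathit{BGO}_N(q)$.
   Context: BCCSP processes over a set $\mathit{Act}$: $p ::= \mathbf{0}\mid ap\mid p+q$; transitions $ap\xrightarrow{a}p$, and $p\xrightarrow{a}p'$ implies $p+q\xrightarrow{a}p'$ and $q+p\xrightarrow{a}p'$; $p\overset{\alpha}{\Rightarrow}q$ for sequences. $I(p)=\{a\mid\exists p'.\,p\xrightarrow{a}p'\}$; $T(p)=\{\alpha\mid\exists p'.\,p\overset{\alpha}{\Rightarrow}p'\}$. For a relation $N$ on processes, an $N$-constrained simulation is a relation $R$ such that $pRq$ implies $pNq$ and, for every $p\xrightarrow{a}p'$, there is $q\xrightarrow{a}q'$ with $p'Rq'$; $p\sqsubseteq_{NS}q$ iff $pRq$ for some such $R$. Constraints: $U$ is the universal relation; $pIq\iff I(p)=I(q)$; $pCq\iff (I(p)=\emptyset\iff I(q)=\emptyset)$; $pTq\iff T(p)=T(q)$; $pSq\iff p\sqsubseteq_{US}q$ and $q\sqsubseteq_{US}p$ (simulation equivalence). Local observations: $L_U(p)=\cdot$ (a single constant); $L_I(p)=I(p)$; $L_C(p)=\mathit{true}$ if $I(p)=\emptyset$ and $\mathit{false}$ otherwise; $L_T(p)=T(p)$; $L_S(p)$ is the equivalence class of $p$ under simulation equivalence. Branching general observations: finite trees $\langle l,S\rangle$ with $l$ a local observation and $S$ a finite set of pairs $(a,b)$, $a\in\mathit{Act}$, $b$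 a branching observation. $\mathit{BGO}_N(p)$ is the (inductively defined) set of all $\langle L_N(p),S\rangle$ with $S$ a finite subset of $\{(a,b)\mid p\xrightarrow{a}p',\ b\in\mathit{BGO}_N(p')\}$. -}

module Defs where

open import Level using (Level; _⊔_) renaming (suc to lsuc; zero to lzero)
open import Data.Unit using (⊤)
import Data.Unit
open import Data.Empty using (⊥)
open import Data.Product using (Σ; ∃; _×_; _,_; proj₁; proj₂)
open import Data.List using (List; []; _∷_)
open import Data.List.Relation.Unary.All using (All)
open import Relation.Nullary using (¬_)
open import Function.Bundles using (_⇔_)

module BCCSP (Act : Set) where

  infixr 6 _·_
  infixl 5 _+_

  data Proc : Set where
    𝟎   : Proc
    _·_ : Act → Proc → Proc
    _+_ : Proc → Proc → Proc

  data _─[_]→_ : Proc → Act → Proc → Set where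
    pre  : ∀ {a p} → (a · p) ─[ a ]→ p
    sumˡ : ∀ {p q a p'} → p ─[ a ]→ p' → (p + q) ─[ a ]→ p'
    sumʳ : ∀ {p q a p'} → p ─[ a ]→ p' → (q + p) ─[ a ]→ p'

  data _═[_]⇒_ : Proc → List Act → Proc → Set where
    done : ∀ {p} → p ═[ [] ]⇒ p
    step : ∀ {p a p' α p''} → p ─[ a ]→ p' → p' ═[ α ]⇒ p'' → p ═[ a ∷ α ]⇒ p''

  I : Proc → Act → Set
  I p a = ∃ λ p' → p ─[ a ]→ p'

  T : Proc → List Act → Set
  T p α = ∃ λ p' → p ═[ α ]⇒ p'

  Idle : Proc → Set
  Idle p = ∀ a → ¬ I p a

  Rel : Set₁
  Rel = Proc → Proc → Set

  Rel₁ : Set₂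
  Rel₁ = Proc → Proc → Set₁

  record IsConstrainedSim (N : Rel₁) (R : Rel) : Set₁ where
    field
      constr : ∀ {p q} → R p q → N p q
      sim    : ∀ {p q a p'} → R p q → p ─[ a ]→ p' →
               ∃ λ q' → (q ─[ a ]→ q') × R p' q'

  _⊑[_]S_ : Proc → Rel₁ → Proc → Set₁
  p ⊑[ N ]S q = Σ Rel λ R → IsConstrainedSim N R × R p q

  Uʳ : Rel₁
  Uʳ _ _ = Level.Lift _ ⊤

  _⊑S_ : Proc → Proc → Set₁
  p ⊑S q = p ⊑[ Uʳ ]S q

  _≃S_ : Proc → Proc → Set₁
  p ≃S q = (p ⊑S q) × (q ⊑S p)

  data Constraint : Set where
    U I' C T' S : Constraint

  ⟦_⟧ : Constraint → Rel₁
  ⟦ U  ⟧ p q = Level.Lift _ ⊤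
  ⟦ I' ⟧ p q = Level.Lift _ (∀ a → (I p a ⇔ I q a))
  ⟦ C  ⟧ p q = Level.Lift _ (Idle p ⇔ Idle q)
  ⟦ T' ⟧ p q = Level.Lift _ (∀ α → (T p α ⇔ T q α))
  ⟦ S  ⟧ p q = p ≃S q

  -- Sets are predicates; the
  -- simulation-equivalence class of p is the predicate (λ r → r ≃S p);
  -- the truth value L_C(p) is the proposition "I(p) = ∅".
  Label : Constraint → Set₂
  Label U  = Level.Lift _ ⊤
  Label I' = Level.Lift _ (Act → Set)
  Label C  = Level.Lift _ Set
  Label T' = Level.Lift _ (List Act → Set)
  Label S  = Proc → Set₁

  LabelEq : (N : Constraint) → Label N → Label N → Set₁
  LabelEq U  _ _ = Level.Lift _ ⊤
  LabelEq I' (Level.lift X) (Level.lift Y) = Level.Lift _ (∀ a → (X a ⇔ Y a))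
  LabelEq C  (Level.lift X) (Level.lift Y) = Level.Lift _ (X ⇔ Y)
  LabelEq T' (Level.lift X) (Level.lift Y) = Level.Lift _ (∀ α → (X α ⇔ Y α))
  LabelEq S  X Y = ∀ r → (X r ⇔ Y r)

  L : (N : Constraint) → Proc → Label N
  L U  p = Level.lift Data.Unit.tt
  L I' p = Level.lift (I p)
  L C  p = Level.lift (Idle p)
  L T' p = Level.lift (T p)
  L S  p = λ r → r ≃S p

  -- Branching general observations: finite trees ⟨ l , S ⟩ whose
  -- finite set S of pairs (a , b) is represented by a list.
  data Obs (Lbl : Set₂) : Set₂ where
    ⟨_,_⟩ : Lbl → List (Act × Obs Lbl) → Obs Lbl

  data BGO (N : Constraint) : Proc → Obs (Label N) → Set₂ where
    obs : ∀ {p} {l : Label N} {Sb : List (Act × Obs (Label N))} →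
          LabelEq N l (L N p) →
          All (λ ab → ∃ λ p' → (p ─[ proj₁ ab ]→ p') × BGO N p' (proj₂ ab)) Sb →
          BGO N p ⟨ l , Sb ⟩

  _⊆BGO[_]_ : Proc → Constraint → Proc → Set₂
  p ⊆BGO[ N ] q = ∀ (b : Obs (Label N)) → BGO N p b → BGO N q b

-- An N-constrained simulation transports branching observations, because every
-- local observation L_N is invariant under the constraint N.  Conversely, the
-- characteristic observation χ(p) = ⟨ L_N(p) , {(a , χ(p')) | p -a-> p'} ⟩ lies in
-- BGO_N(p), and every q with χ(p) ∈ BGO_N(q) answers each step of p by a step to a
-- process again having the characteristic observation of the derivative; this
-- yields an N-constrained simulation relating p and q.
module Submission where

open import Defs
open import Function.Bundles using (_⇔_; mk⇔; Equivalence)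
import Function.Properties.Equivalence as ⇔
open import Level using (lift; lower)
open import Data.Unit using (⊤; tt)
open import Data.Product using (∃; _×_; _,_; proj₁; proj₂)
open import Data.List using (List; []; _∷_; _++_)
open import Data.List.Relation.Unary.All as All using (All; []; _∷_)
open import Data.List.Relation.Unary.All.Properties using (++⁺; ++⁻ˡ; ++⁻ʳ)
open import Relation.Binary.PropositionalEquality using (_≡_; refl)

module Characterisation (Act : Set) where
  open BCCSP Act
  open IsConstrainedSim

  ⊑S-refl : ∀ p → p ⊑S p
  ⊑S-refl p = _≡_ , record { constr = λ _ → lift tt ; sim = λ { refl t → _ , t , refl } } , refl

  ⊑S-trans : ∀ {p q r} → p ⊑S q → q ⊑S r → p ⊑S r
  ⊑S-trans (R , isR , pRq) (R' , isR' , qR'r) =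
    (λ x z → ∃ λ y → R x y × R' y z) ,
    record { constr = λ _ → lift tt
           ; sim    = λ { (y , xRy , yR'z) t →
               let (y' , ty , x'Ry') = sim isR xRy t
                   (z' , tz , y'R'z') = sim isR' yR'z ty
               in z' , tz , (y' , x'Ry' , y'R'z') } } ,
    (_ , pRq , qR'r)

  ≃S-sym : ∀ {p q} → p ≃S q → q ≃S p
  ≃S-sym (p⊑q , q⊑p) = q⊑p , p⊑q

  ≃S-trans : ∀ {p q r} → p ≃S q → q ≃S r → p ≃S r
  ≃S-trans (p⊑q , q⊑p) (q⊑r , r⊑q) = ⊑S-trans p⊑q q⊑r , ⊑S-trans r⊑q q⊑p

  -- It is needed
  -- because the relation witnessing p ⊑[ N ]S q must be Set-valued, whereas
  -- ⟦ S ⟧ (simulation equivalence) lives in Set₁.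
  data Sim (N₀ : Rel) : Rel where
    mkSim : ∀ {p q} → N₀ p q →
            (∀ {a p'} → p ─[ a ]→ p' → ∃ λ q' → (q ─[ a ]→ q') × Sim N₀ p' q') →
            Sim N₀ p q

  Sim-isConstrainedSim : ∀ {N : Rel₁} {N₀ : Rel} → (∀ {p q} → N₀ p q → N p q) →
                         IsConstrainedSim N (Sim N₀)
  Sim-isConstrainedSim N₀⇒N = record
    { constr = λ { (mkSim n₀ _) → N₀⇒N n₀ }
    ; sim    = λ { (mkSim _ answer) t → answer t } }

  -- Termination is by recursion on the syntax of p: a derivative of p is a subterm.
  module _ {N : Rel₁} {N₀ : Rel} (N⇒N₀ : ∀ {p q} → N p q → N₀ p q)
           {R : Rel} (isR : IsConstrainedSim N R) where
    mutual
      constrainedSim⊆Sim : ∀ p {q} → R p q → Sim N₀ p q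
      constrainedSim⊆Sim p pRq = mkSim (N⇒N₀ (constr isR pRq)) λ t →
        let (q' , tq , p'Rq') = sim isR pRq t in q' , tq , derivative⊆Sim p t p'Rq'

      derivative⊆Sim : ∀ p {a p' q'} → p ─[ a ]→ p' → R p' q' → Sim N₀ p' q'
      derivative⊆Sim (a · p)   pre      = constrainedSim⊆Sim p
      derivative⊆Sim (p₁ + p₂) (sumˡ t) = derivative⊆Sim p₁ t
      derivative⊆Sim (p₁ + p₂) (sumʳ t) = derivative⊆Sim p₂ t

  Similar : Rel
  Similar = Sim (λ _ _ → ⊤)

  ⊑S⇒Similar : ∀ {p q} → p ⊑S q → Similar p q
  ⊑S⇒Similar (R , isR , pRq) = constrainedSim⊆Sim (λ _ → tt) isR _ pRq

  Similar⇒⊑S : ∀ {p q} → Similar p q → p ⊑S q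
  Similar⇒⊑S s = Similar , Sim-isConstrainedSim (λ _ → lift tt) , s

  ⟦_⟧₀ : Constraint → Rel
  ⟦ U  ⟧₀ p q = ⊤
  ⟦ I' ⟧₀ p q = ∀ a → (I p a ⇔ I q a)
  ⟦ C  ⟧₀ p q = Idle p ⇔ Idle q
  ⟦ T' ⟧₀ p q = ∀ α → (T p α ⇔ T q α)
  ⟦ S  ⟧₀ p q = Similar p q × Similar q p

  ⟦⟧₀⇒⟦⟧ : ∀ N {p q} → ⟦ N ⟧₀ p q → ⟦ N ⟧ p q
  ⟦⟧₀⇒⟦⟧ U  _ = lift tt
  ⟦⟧₀⇒⟦⟧ I' e = lift e
  ⟦⟧₀⇒⟦⟧ C  e = lift e
  ⟦⟧₀⇒⟦⟧ T' e = lift e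
  ⟦⟧₀⇒⟦⟧ S  (p≤q , q≤p) = Similar⇒⊑S p≤q , Similar⇒⊑S q≤p

  LabelEq-refl : ∀ N p → LabelEq N (L N p) (L N p)
  LabelEq-refl U  p = lift tt
  LabelEq-refl I' p = lift λ _ → ⇔.refl
  LabelEq-refl C  p = lift ⇔.refl
  LabelEq-refl T' p = lift λ _ → ⇔.refl
  LabelEq-refl S  p = λ _ → ⇔.refl

  LabelEq-respʳ : ∀ N {l p q} → LabelEq N l (L N p) → ⟦ N ⟧ p q → LabelEq N l (L N q)
  LabelEq-respʳ U  _ _ = lift tt
  LabelEq-respʳ I' e c = lift λ a → ⇔.trans (lower e a) (lower c a)
  LabelEq-respʳ C  e c = lift (⇔.trans (lower e) (lower c))
  LabelEq-respʳ T' e c = lift λ α → ⇔.trans (lower e α) (lower c α)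
  LabelEq-respʳ S  e c = λ r →
    ⇔.trans (e r) (mk⇔ (λ r≃p → ≃S-trans r≃p c) (λ r≃q → ≃S-trans r≃q (≃S-sym c)))

  -- For S: p lies in its own class, hence in the class of q.
  LabelEq⇒⟦⟧₀ : ∀ N {p q} → LabelEq N (L N p) (L N q) → ⟦ N ⟧₀ p q
  LabelEq⇒⟦⟧₀ U  _ = tt
  LabelEq⇒⟦⟧₀ I' e = lower e
  LabelEq⇒⟦⟧₀ C  e = lower e
  LabelEq⇒⟦⟧₀ T' e = lower e
  LabelEq⇒⟦⟧₀ S {p} e =
    let (p⊑q , q⊑p) = Equivalence.to (e p) (⊑S-refl p , ⊑S-refl p)
    in ⊑S⇒Similar p⊑q , ⊑S⇒Similar q⊑p

  Branches : (N : Constraint) → Proc → List (Act × Obs (Label N)) → Set₂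
  Branches N p = All λ ab → ∃ λ p' → (p ─[ proj₁ ab ]→ p') × BGO N p' (proj₂ ab)

  module _ {N : Constraint} {R : Rel} (isR : IsConstrainedSim ⟦ N ⟧ R) where
    mutual
      constrainedSim⇒BGO⊆ : ∀ {p q b} → R p q → BGO N p b → BGO N q b
      constrainedSim⇒BGO⊆ pRq (obs l≈Lp bs) =
        obs (LabelEq-respʳ N l≈Lp (constr isR pRq)) (constrainedSim⇒Branches⊆ pRq bs)

      constrainedSim⇒Branches⊆ : ∀ {p q Sb} → R p q → Branches N p Sb → Branches N q Sb
      constrainedSim⇒Branches⊆ pRq [] = []
      constrainedSim⇒Branches⊆ pRq ((p' , t , b∈p') ∷ bs) =
        let (q' , tq , p'Rq') = sim isR pRq t
        in (q' , tq , constrainedSim⇒BGO⊆ p'Rq' b∈p') ∷ constrainedSim⇒Branches⊆ pRq bs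

  module _ (N : Constraint) where
    mutual
      χ : Proc → Obs (Label N)
      χ p = ⟨ L N p , χ-branches p ⟩

      χ-branches : Proc → List (Act × Obs (Label N))
      χ-branches 𝟎         = []
      χ-branches (a · p)   = (a , χ p) ∷ []
      χ-branches (p₁ + p₂) = χ-branches p₁ ++ χ-branches p₂

    mutual
      χ∈BGO : ∀ p → BGO N p (χ p)
      χ∈BGO p = obs (LabelEq-refl N p) (χ-branches-realised p)

      χ-branches-realised : ∀ p → Branches N p (χ-branches p)
      χ-branches-realised 𝟎         = []
      χ-branches-realised (a · p)   = (p , pre , χ∈BGO p) ∷ []
      χ-branches-realised (p₁ + p₂) =
        ++⁺ (All.map (λ (p' , t , b) → p' , sumˡ t , b) (χ-branches-realised p₁))
            (All.map (λ (p' , t , b) → p' , sumʳ t , b) (χ-branches-realised p₂))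

    mutual
      χ∈BGO⇒Sim : ∀ p {q} → BGO N q (χ p) → Sim ⟦ N ⟧₀ p q
      χ∈BGO⇒Sim p (obs Lp≈Lq bs) = mkSim (LabelEq⇒⟦⟧₀ N Lp≈Lq) λ t → χ-branches-answer p t bs

      χ-branches-answer : ∀ p {q a p'} → p ─[ a ]→ p' → Branches N q (χ-branches p) →
                          ∃ λ q' → (q ─[ a ]→ q') × Sim ⟦ N ⟧₀ p' q'
      χ-branches-answer (a · p)   pre      ((q' , tq , χp∈q') ∷ []) = q' , tq , χ∈BGO⇒Sim p χp∈q'
      χ-branches-answer (p₁ + p₂) (sumˡ t) bs = χ-branches-answer p₁ t (++⁻ˡ (χ-branches p₁) bs)
      χ-branches-answer (p₁ + p₂) (sumʳ t) bs = χ-branches-answer p₂ t (++⁻ʳ (χ-branches p₁) bs)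

theorem4p9 : (Act : Set) → let open BCCSP Act in
    (N : Constraint) (p q : Proc) → (p ⊑[ ⟦ N ⟧ ]S q) ⇔ (p ⊆BGO[ N ] q)
theorem4p9 Act N p q = mk⇔
  (λ (R , isR , pRq) _ → constrainedSim⇒BGO⊆ isR pRq)
  (λ p⊆q → Sim ⟦ N ⟧₀ , Sim-isConstrainedSim (⟦⟧₀⇒⟦⟧ N) , χ∈BGO⇒Sim N p (p⊆q (χ N p) (χ∈BGO N p)))
  where open Characterisation Act
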